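{- Let $n>3$ be an integer such that $p=4n-1$ is prime, and let $M=\lfloor n^2/p\rfloor$. Let $J_n$ denote the number of integers $k$ with $2\le k\le n+2$ such that $r_p((k-1)^2)+r_p(k+1-3n)\ge p$. Then \begin{align*} \sum_{k=1}^{p-1} r_p(k^2-k+2-3n) &= \sum_{k=1}^{p-1} r_p(k^2)+3n-2,\\ \sum_{k=1}^{2n} r_p(k^2-k+2-3n) &= \sum_{k=1}^{2n} r_p(k^2)+n,\\ \sum_{k=1}^{n} r_p(k^2-k+2-3n) &= \sum_{k=1}^{n} r_p(k^2)+\frac{n(n+1)}{2}-p\,(J_n-1-M). \end{align*}
   Context: For a positive integer $q$ and $x\in\mathbb{Z}$, $r_q(x)\in\{0,1,\dots,q-1\}$ denotes the remainder of $x$ upon division by $q$, i.e. $x=q\lfloor x/q\rfloor+r_q(x)$. -}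

module Defs where

open import Data.Nat as ℕ using (ℕ; zero; suc; _≤_; _≤?_)
open import Data.Integer as ℤ using (ℤ; _%ℕ_)
open import Relation.Nullary.Decidable using (does)
open import Data.Bool using (if_then_else_)

-- r q x : remainder of x upon division by q, in {0,…,q-1}.
-- Only used with q ≥ 1; the value for q = 0 is an irrelevant convention.
r : ℕ → ℤ → ℕ
r zero    x = 0
r (suc q) x = x %ℕ suc q

-- Σ[a ≤ k ≤ b] f k  (empty when b < a); sumFromTo a b f = f a + … + f b
sumFromTo : ℕ → ℕ → (ℕ → ℕ) → ℕ
sumFromTo a b f = go (suc b ℕ.∸ a)
  where
  go : ℕ → ℕ
  go zero    = 0
  go (suc i) = f (a ℕ.+ i) ℕ.+ go i

countFromTo : ℕ → ℕ → (ℕ → Data.Bool.Bool) → ℕ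
countFromTo a b P = sumFromTo a b (λ k → if P k then 1 else 0)

J : ℕ → ℕ
J n = countFromTo 2 (n ℕ.+ 2)
        (λ k → does (p ≤? (r p ((ℤ.+ k ℤ.- ℤ.+ 1) ℤ.* (ℤ.+ k ℤ.- ℤ.+ 1))
                           ℕ.+ r p (ℤ.+ k ℤ.+ ℤ.+ 1 ℤ.- ℤ.+ (3 ℕ.* n)))))
  where p = 4 ℕ.* n ℕ.∸ 1

-- ⌊m / q⌋ for q ≥ 1 (value for q = 0 is an irrelevant convention)
fl : ℕ → ℕ → ℕ
fl m zero    = 0
fl m (suc q) = m ℕ./ suc q

{-# OPTIONS --safe #-}
-- Write g k = r_p(k²). Since 4n ≡ 1 (mod p),
--   k² − k + 2 − 3n ≡ (k − 2n)² + 1 (mod p),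
-- and since p ≡ 3 (mod 4), −1 is not a square mod p (by Fermat), so taking the
-- remainder never wraps around: r_p(k² − k + 2 − 3n) = g |k − 2n| + 1.  The first two
-- identities follow by reindexing sums of g, using g (p − k) = g k and
-- g (2n) = g (2n − 1) = n.  For the third, (2n − k)² ≡ k² + (n − k), so
-- g (2n − k) = g k + (n − k) − p c_k with carries c_k ∈ {0, 1}.  The k-th summand of J_n
-- (k = m + 1) equals c_{m+1} + ⌊(m+1)²/p⌋ − ⌊m²/p⌋ for m < n, once more because −1 is a
-- non-residue, so these telescope to Σ c + ⌊n²/p⌋; the last two summands contribute
-- exactly 1 because r_p(n²) ≤ p − 5, which follows from 16n² ≡ 1 (mod p) and n > 3.

module Submission where

open import Defs
open import Data.Nat as ℕ
open import Data.Nat.Properties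
open import Data.Nat.DivMod
open import Data.Nat.Divisibility
open import Data.Nat.Primality
open import Data.Nat.Combinatorics
open import Data.Nat.Tactic.RingSolver using (solve-∀)
open import Data.Integer as ℤ using (ℤ; -[1+_]; _%ℕ_; _/ℕ_)
import Data.Integer.Properties as ℤ
open import Data.Integer.DivMod using (a≡a%ℕn+[a/ℕn]*n; n%ℕd<d)
import Data.Integer.Tactic.RingSolver as ℤ-Solver
open import Data.Fin as Fin using (Fin; toℕ; inject₁; fromℕ)
open import Data.Fin.Properties using (toℕ-inject₁; toℕ-fromℕ; toℕ<n)
open import Data.Vec.Functional using (Vector; init; tail)
open import Data.Bool using (Bool; if_then_else_)
open import Data.Product using (_×_; _,_)
open import Data.Sum using ([_,_]′)
open import Function using (id)
open import Data.Empty using (⊥-elim)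
open import Relation.Nullary using (¬_; yes; no; does)
open import Relation.Nullary.Decidable using (dec-true; dec-false; from-yes; _→-dec_; ¬?)
open import Relation.Binary.PropositionalEquality hiding (J)
open import Algebra.Properties.CommutativeSemigroup +-commutativeSemigroup
  using (x∙yz≈y∙xz; x∙yz≈yx∙z; xy∙z≈xz∙y; interchange)
import Algebra.Properties.CommutativeSemiring.Binomial +-*-commutativeSemiring as Binomial
import Algebra.Properties.Monoid.Sum +-0-monoid as MonoidSum
open import Algebra.Properties.Semiring.Exp +-*-semiring using () renaming (_^_ to _^′_)
open import Algebra.Definitions.RawMonoid +-0-rawMonoid using () renaming (_×_ to _×′_)

-- Finite sums

∑< : ℕ → (ℕ → ℕ) → ℕ
∑< zero    h = 0
∑< (suc N) h = h N + ∑< N h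

sumFromTo1≡∑< : ∀ b h → sumFromTo 1 b h ≡ ∑< b (λ i → h (suc i))
sumFromTo1≡∑< zero    h = refl
sumFromTo1≡∑< (suc b) h = cong (h (suc b) +_) (sumFromTo1≡∑< b h)

sumFromTo2≡∑< : ∀ b h → sumFromTo 2 (suc b) h ≡ ∑< b (λ i → h (2 + i))
sumFromTo2≡∑< zero    h = refl
sumFromTo2≡∑< (suc b) h = cong (h (2 + b) +_) (sumFromTo2≡∑< b h)

∑<-cong : ∀ N {h h′} → (∀ i → i < N → h i ≡ h′ i) → ∑< N h ≡ ∑< N h′
∑<-cong zero    eq = refl
∑<-cong (suc N) eq = cong₂ _+_ (eq N ≤-refl) (∑<-cong N (λ i i<N → eq i (m<n⇒m<1+n i<N)))

∑<-distrib-+ : ∀ N h h′ → ∑< N (λ i → h i + h′ i) ≡ ∑< N h + ∑< N h′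
∑<-distrib-+ zero    h h′ = refl
∑<-distrib-+ (suc N) h h′ =
  trans (cong (h N + h′ N +_) (∑<-distrib-+ N h h′)) (interchange (h N) (h′ N) (∑< N h) (∑< N h′))

∑<-const : ∀ N c → ∑< N (λ _ → c) ≡ N * c
∑<-const zero    c = refl
∑<-const (suc N) c = cong (c +_) (∑<-const N c)

∑<-distribˡ-* : ∀ N c h → ∑< N (λ i → c * h i) ≡ c * ∑< N h
∑<-distribˡ-* zero    c h = sym (*-zeroʳ c)
∑<-distribˡ-* (suc N) c h =
  trans (cong (c * h N +_) (∑<-distribˡ-* N c h)) (sym (*-distribˡ-+ c (h N) (∑< N h)))

∑<-suc : ∀ N h → ∑< (suc N) h ≡ h 0 + ∑< N (λ i → h (suc i))
∑<-suc zero    h = refl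
∑<-suc (suc N) h =
  trans (cong (h (suc N) +_) (∑<-suc N h)) (x∙yz≈y∙xz (h (suc N)) (h 0) (∑< N (λ i → h (suc i))))

∑<-+ : ∀ M N h → ∑< (M + N) h ≡ ∑< M h + ∑< N (λ i → h (M + i))
∑<-+ zero    N h = refl
∑<-+ (suc M) N h = begin
  ∑< (suc (M + N)) h                                             ≡⟨ ∑<-suc (M + N) h ⟩
  h 0 + ∑< (M + N) (λ i → h (suc i))                             ≡⟨ cong (h 0 +_) (∑<-+ M N (λ i → h (suc i))) ⟩
  h 0 + (∑< M (λ i → h (suc i)) + ∑< N (λ i → h (suc M + i)))    ≡⟨ sym (+-assoc (h 0) _ _) ⟩
  h 0 + ∑< M (λ i → h (suc i)) + ∑< N (λ i → h (suc M + i))      ≡⟨ cong (_+ ∑< N (λ i → h (suc M + i))) (sym (∑<-suc M h)) ⟩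
  ∑< (suc M) h + ∑< N (λ i → h (suc M + i))                      ∎
  where open ≡-Reasoning

∑<-reverse : ∀ N h → ∑< N (λ i → h (N ∸ suc i)) ≡ ∑< N h
∑<-reverse zero    h = refl
∑<-reverse (suc N) h = begin
  h (N ∸ N) + ∑< N (λ i → h (suc N ∸ suc i))
    ≡⟨ cong₂ _+_ (cong h (n∸n≡0 N)) (∑<-cong N (λ i i<N → cong h (+-∸-assoc 1 i<N))) ⟩
  h 0 + ∑< N (λ i → h (suc (N ∸ suc i)))
    ≡⟨ cong (h 0 +_) (∑<-reverse N (λ i → h (suc i))) ⟩
  h 0 + ∑< N (λ i → h (suc i))
    ≡⟨ sym (∑<-suc N h) ⟩
  ∑< (suc N) h
    ∎
  where open ≡-Reasoning

∑<-telescope : ∀ N {a b F : ℕ → ℕ} → (∀ i → i < N → a i + F i ≡ b i + F (suc i)) →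
               ∑< N a + F 0 ≡ ∑< N b + F N
∑<-telescope zero    step = refl
∑<-telescope (suc N) {a} {b} {F} step = begin
  a N + ∑< N a + F 0          ≡⟨ +-assoc (a N) _ _ ⟩
  a N + (∑< N a + F 0)        ≡⟨ cong (a N +_) (∑<-telescope N {a} {b} {F} (λ i i<N → step i (m<n⇒m<1+n i<N))) ⟩
  a N + (∑< N b + F N)        ≡⟨ x∙yz≈y∙xz (a N) (∑< N b) (F N) ⟩
  ∑< N b + (a N + F N)        ≡⟨ cong (∑< N b +_) (step N ≤-refl) ⟩
  ∑< N b + (b N + F (suc N))  ≡⟨ x∙yz≈yx∙z (∑< N b) (b N) (F (suc N)) ⟩
  b N + ∑< N b + F (suc N)    ∎
  where open ≡-Reasoning

∑<-suc≡triangle : ∀ N → ∑< N suc ≡ (N * (N + 1)) / 2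
∑<-suc≡triangle N = sym (begin
  (N * (N + 1)) / 2      ≡⟨ cong (λ M → (N * M) / 2) (+-comm N 1) ⟩
  (N * suc N) / 2        ≡⟨ cong (_/ 2) (sym (∑<-suc*2 N)) ⟩
  (∑< N suc * 2) / 2     ≡⟨ m*n/n≡m (∑< N suc) 2 ⟩
  ∑< N suc               ∎)
  where
  open ≡-Reasoning
  step : ∀ N → suc N * 2 + N * suc N ≡ suc N * suc (suc N)
  step = solve-∀
  ∑<-suc*2 : ∀ N → ∑< N suc * 2 ≡ N * suc N
  ∑<-suc*2 zero    = refl
  ∑<-suc*2 (suc N) =
    trans (*-distribʳ-+ 2 (suc N) (∑< N suc)) (trans (cong (suc N * 2 +_) (∑<-suc*2 N)) (step N))

-- Remainders and quotients

pos-+-* : ∀ a b c → ℤ.+ (a + b * c) ≡ ℤ.+ a ℤ.+ ℤ.+ b ℤ.* ℤ.+ c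
pos-+-* a b c = trans (ℤ.pos-+ a (b * c)) (cong (λ y → ℤ.+ a ℤ.+ y) (ℤ.pos-* b c))

module _ {d : ℕ} .{{_ : NonZero d}} where

  r+kd%d≡r : ∀ {ρ} k → ρ < d → (ρ + k * d) % d ≡ ρ
  r+kd%d≡r {ρ} k ρ<d = trans ([m+kn]%n≡m%n ρ k d) (m<n⇒m%n≡m ρ<d)

  [m%d+n]%d≡[m+n]%d : ∀ m n → (m % d + n) % d ≡ (m + n) % d
  [m%d+n]%d≡[m+n]%d m n = begin
    (m % d + n) % d                ≡⟨ sym ([m+kn]%n≡m%n (m % d + n) (m / d) d) ⟩
    (m % d + n + m / d * d) % d    ≡⟨ cong (_% d) (xy∙z≈xz∙y (m % d) n (m / d * d)) ⟩
    (m % d + m / d * d + n) % d    ≡⟨ cong (λ x → (x + n) % d) (sym (m≡m%n+[m/n]*n m d)) ⟩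
    (m + n) % d                    ∎
    where open ≡-Reasoning

  [m+n]/d≡m/d+[m%d+n]/d : ∀ m n → (m + n) / d ≡ m / d + (m % d + n) / d
  [m+n]/d≡m/d+[m%d+n]/d m n = begin
    (m + n) / d                    ≡⟨ cong (λ x → (x + n) / d) (m≡m%n+[m/n]*n m d) ⟩
    (m % d + m / d * d + n) / d    ≡⟨ cong (_/ d) (xy∙z≈xz∙y (m % d) (m / d * d) n) ⟩
    (m % d + n + m / d * d) / d    ≡⟨ +-distrib-/-∣ʳ (m % d + n) (n∣m*n (m / d)) ⟩
    (m % d + n) / d + m / d * d / d ≡⟨ cong (λ x → (m % d + n) / d + x) (m*n/n≡m (m / d) d) ⟩
    (m % d + n) / d + m / d        ≡⟨ +-comm _ (m / d) ⟩
    m / d + (m % d + n) / d        ∎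
    where open ≡-Reasoning

  1+m%d<d : ∀ m → ¬ d ∣ suc m → suc (m % d) < d
  1+m%d<d m d∤1+m = ≤∧≢⇒< (m%n<n m d) λ 1+m%d≡d → d∤1+m (divides (suc (m / d)) (begin
    suc m                         ≡⟨ cong suc (m≡m%n+[m/n]*n m d) ⟩
    suc (m % d) + m / d * d       ≡⟨ cong (_+ m / d * d) 1+m%d≡d ⟩
    suc (m / d) * d               ∎))
    where open ≡-Reasoning

  [1+m]%d≡1+m%d : ∀ m → ¬ d ∣ suc m → suc m % d ≡ suc (m % d)
  [1+m]%d≡1+m%d m d∤1+m = begin
    suc m % d                        ≡⟨ cong (λ x → suc x % d) (m≡m%n+[m/n]*n m d) ⟩
    (suc (m % d) + m / d * d) % d    ≡⟨ r+kd%d≡r (m / d) (1+m%d<d m d∤1+m) ⟩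
    suc (m % d)                      ∎
    where open ≡-Reasoning

  [1+m]/d≡m/d : ∀ m → ¬ d ∣ suc m → suc m / d ≡ m / d
  [1+m]/d≡m/d m d∤1+m = begin
    suc m / d                         ≡⟨ cong (_/ d) (+-comm 1 m) ⟩
    (m + 1) / d                       ≡⟨ [m+n]/d≡m/d+[m%d+n]/d m 1 ⟩
    m / d + (m % d + 1) / d           ≡⟨ cong (λ x → m / d + x / d) (+-comm (m % d) 1) ⟩
    m / d + suc (m % d) / d           ≡⟨ cong (m / d +_) (m<n⇒m/n≡0 (1+m%d<d m d∤1+m)) ⟩
    m / d + 0                         ≡⟨ +-identityʳ (m / d) ⟩
    m / d                             ∎
    where open ≡-Reasoning

  [d≤x]≡x/d : ∀ {x} → x < d + d → (if does (d ≤? x) then 1 else 0) ≡ x / d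
  [d≤x]≡x/d {x} x<2d with d ≤? x
  ... | no  d≰x rewrite dec-false (d ≤? x) d≰x = sym (m<n⇒m/n≡0 (≰⇒> d≰x))
  ... | yes d≤x rewrite dec-true (d ≤? x) d≤x = sym (begin
    x / d               ≡⟨ m/n≡1+[m∸n]/n d≤x ⟩
    suc ((x ∸ d) / d)   ≡⟨ cong suc (m<n⇒m/n≡0 (subst (x ∸ d <_) (m+n∸m≡n d d) (∸-monoˡ-< x<2d d≤x))) ⟩
    1                   ∎)
    where open ≡-Reasoning

  +m≡+r+td⇒m%d≡r : ∀ m {ρ} t → ρ < d → ℤ.+ m ≡ ℤ.+ ρ ℤ.+ t ℤ.* ℤ.+ d → m % d ≡ ρ
  +m≡+r+td⇒m%d≡r m {ρ} (ℤ.+ k) ρ<d eq =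
    trans (cong (_% d) (ℤ.+-injective (trans eq (sym (pos-+-* ρ k d))))) (r+kd%d≡r k ρ<d)
  +m≡+r+td⇒m%d≡r m {ρ} t@(-[1+ k ]) ρ<d eq = ⊥-elim (<⇒≱ ρ<d (begin
    d                      ≤⟨ m≤n+m d (m + k * d) ⟩
    m + k * d + d          ≡⟨ +-assoc m (k * d) d ⟩
    m + (k * d + d)        ≡⟨ cong (m +_) (+-comm (k * d) d) ⟩
    m + suc k * d          ≡⟨ ℤ.+-injective (sym ρ≡m+[-t]d) ⟩
    ρ                      ∎))
    where
    open ≤-Reasoning
    cancel : ∀ b t D → b ≡ b ℤ.+ t ℤ.* D ℤ.+ ℤ.- t ℤ.* D
    cancel = ℤ-Solver.solve-∀
    move : ∀ a b t D → a ≡ b ℤ.+ t ℤ.* D → b ≡ a ℤ.+ ℤ.- t ℤ.* D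
    move a b t D refl = cancel b t D
    ρ≡m+[-t]d : ℤ.+ ρ ≡ ℤ.+ (m + suc k * d)
    ρ≡m+[-t]d = trans (move (ℤ.+ m) (ℤ.+ ρ) t (ℤ.+ d) eq) (sym (pos-+-* m (suc k) d))

x+cd≡m⇒r[x]≡m%d : ∀ {d} .{{_ : NonZero d}} x c {m} → x ℤ.+ c ℤ.* ℤ.+ d ≡ ℤ.+ m → r d x ≡ m % d
x+cd≡m⇒r[x]≡m%d {d@(suc _)} x c {m} eq = sym (+m≡+r+td⇒m%d≡r m (x /ℕ d ℤ.+ c) (n%ℕd<d x d) (begin
  ℤ.+ m                                           ≡⟨ sym eq ⟩
  x ℤ.+ c ℤ.* D                                   ≡⟨ cong (ℤ._+ c ℤ.* D) (a≡a%ℕn+[a/ℕn]*n x d) ⟩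
  ℤ.+ (x %ℕ d) ℤ.+ x /ℕ d ℤ.* D ℤ.+ c ℤ.* D       ≡⟨ collect (ℤ.+ (x %ℕ d)) (x /ℕ d) c D ⟩
  ℤ.+ (x %ℕ d) ℤ.+ (x /ℕ d ℤ.+ c) ℤ.* D           ∎))
  where
  open ≡-Reasoning
  D = ℤ.+ d
  collect : ∀ a q c D → a ℤ.+ q ℤ.* D ℤ.+ c ℤ.* D ≡ a ℤ.+ (q ℤ.+ c) ℤ.* D
  collect = ℤ-Solver.solve-∀

-- Fermat's little theorem and the quadratic character of -1

^′≡^ : ∀ x n → x ^′ n ≡ x ^ n
^′≡^ x zero    = refl
^′≡^ x (suc n) = cong (x *_) (^′≡^ x n)

×′≡* : ∀ n x → n ×′ x ≡ n * x
×′≡* zero    x = refl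
×′≡* (suc n) x = cong (x +_) (×′≡* n x)

∣-sum : ∀ {d} n (v : Vector ℕ n) → (∀ i → d ∣ v i) → d ∣ MonoidSum.sum v
∣-sum zero    v d∣v = _ ∣0
∣-sum (suc n) v d∣v = ∣m∣n⇒∣m+n (d∣v Fin.zero) (∣-sum n (tail v) (λ i → d∣v (Fin.suc i)))

n∣n! : ∀ n .{{_ : NonZero n}} → n ∣ n !
n∣n! (suc n) = m∣m*n (n !)

module _ {p} (p-prime : Prime p) where

  private instance
    p≢0 : NonZero p
    p≢0 = prime⇒nonZero p-prime

  prime∤! : ∀ m → m < p → ¬ p ∣ m !
  prime∤! zero    m<p p∣1  = ¬prime[1] (subst Prime (∣1⇒≡1 p∣1) p-prime)
  prime∤! (suc m) m<p p∣m! = [ (λ p∣1+m → <⇒≱ m<p (∣⇒≤ p∣1+m))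
                             , prime∤! m (<-trans (n<1+n m) m<p) ]′
                             (euclidsLemma (suc m) (m !) p-prime p∣m!)

  prime∣pCk : ∀ {k} → 0 < k → k < p → p ∣ p C k
  prime∣pCk {k} 0<k k<p = [ id , (λ p∣k!*[p∸k]! → ⊥-elim ([ prime∤! k k<p , prime∤! (p ∸ k) p∸k<p ]′
                                     (euclidsLemma (k !) ((p ∸ k) !) p-prime p∣k!*[p∸k]!))) ]′
                          (euclidsLemma (p C k) (k ! * (p ∸ k) !) p-prime p∣pCk*k!*[p∸k]!)
    where
    instance _ = k !* (p ∸ k) !≢0
    p∸k<p : p ∸ k < p
    p∸k<p = ∸-monoʳ-< 0<k (<⇒≤ k<p)
    pCk*k!*[p∸k]!≡p! : (p C k) * (k ! * (p ∸ k) !) ≡ p !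
    pCk*k!*[p∸k]!≡p! = trans (cong (_* (k ! * (p ∸ k) !)) (nCk≡n!/k![n-k]! (<⇒≤ k<p)))
                             (m/n*n≡m (k![n∸k]!∣n! (<⇒≤ k<p)))
    p∣pCk*k!*[p∸k]! : p ∣ (p C k) * (k ! * (p ∸ k) !)
    p∣pCk*k!*[p∸k]! = subst (p ∣_) (sym pCk*k!*[p∸k]!≡p!) (n∣n! p)

freshman's-dream : ∀ {m} → Prime (2 + m) → ∀ a →
                   (a + 1) ^ (2 + m) % (2 + m) ≡ (a ^ (2 + m) + 1) % (2 + m)
freshman's-dream {m} p-prime a = begin
  (a + 1) ^ p % p                               ≡⟨ cong (_% p) (sym (^′≡^ (a + 1) p)) ⟩
  (a + 1) ^′ p % p                              ≡⟨ cong (_% p) (Binomial.theorem p a 1) ⟩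
  (t Fin.zero + MonoidSum.sum (tail t)) % p     ≡⟨ cong (λ x → (t Fin.zero + x) % p) (MonoidSum.sum-init-last (tail t)) ⟩
  (t Fin.zero + (middle + t last)) % p          ≡⟨ cong₂ (λ x y → (x + (middle + y)) % p) (t≡ Fin.zero) (t≡ last) ⟩
  (1 + (middle + (p C toℕ last) * a ^ toℕ last)) % p
                                                ≡⟨ cong (λ k → (1 + (middle + (p C suc k) * a ^ suc k)) % p) (toℕ-fromℕ (suc m)) ⟩
  (1 + (middle + (p C p) * a ^ p)) % p          ≡⟨ cong (λ c → (1 + (middle + c * a ^ p)) % p) (nCn≡1 p) ⟩
  (1 + (middle + 1 * a ^ p)) % p                ≡⟨ cong (_% p) (rearrange middle (a ^ p)) ⟩
  (a ^ p + 1 + middle) % p                      ≡⟨ %-remove-+ʳ (a ^ p + 1) p∣middle ⟩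
  (a ^ p + 1) % p                               ∎
  where
  open ≡-Reasoning
  p = 2 + m
  t : Fin (suc p) → ℕ
  t = Binomial.binomialTerm a 1 p
  last : Fin (suc p)
  last = Fin.suc (fromℕ (suc m))
  middle : ℕ
  middle = MonoidSum.sum (init (tail t))
  t≡ : ∀ i → t i ≡ (p C toℕ i) * a ^ toℕ i
  t≡ i = begin
    (p C toℕ i) ×′ (a ^′ toℕ i * 1 ^′ (p ∸ toℕ i))    ≡⟨ ×′≡* (p C toℕ i) _ ⟩
    (p C toℕ i) * (a ^′ toℕ i * 1 ^′ (p ∸ toℕ i))     ≡⟨ cong₂ (λ x y → (p C toℕ i) * (x * y))
                                                           (^′≡^ a (toℕ i)) (trans (^′≡^ 1 (p ∸ toℕ i)) (^-zeroˡ (p ∸ toℕ i))) ⟩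
    (p C toℕ i) * (a ^ toℕ i * 1)                     ≡⟨ cong ((p C toℕ i) *_) (*-identityʳ (a ^ toℕ i)) ⟩
    (p C toℕ i) * a ^ toℕ i                           ∎
  p∣middle : p ∣ middle
  p∣middle = ∣-sum (suc m) (init (tail t)) λ i → subst (p ∣_) (sym (t≡ (Fin.suc (inject₁ i))))
    (∣m⇒∣m*n _ (prime∣pCk p-prime (s≤s z≤n) (s≤s (s≤s (subst (_≤ m) (sym (toℕ-inject₁ i)) (≤-pred (toℕ<n i)))))))
  rearrange : ∀ x y → 1 + (x + 1 * y) ≡ y + 1 + x
  rearrange = solve-∀

fermat's-little : ∀ {p} .{{_ : NonZero p}} → Prime p → ∀ a → a ^ p % p ≡ a % p
fermat's-little {1} () a
fermat's-little {p@(suc (suc _))} p-prime zero    = refl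
fermat's-little {p@(suc (suc _))} p-prime (suc a) = begin
  suc a ^ p % p                  ≡⟨ cong (λ x → x ^ p % p) (+-comm 1 a) ⟩
  (a + 1) ^ p % p                ≡⟨ freshman's-dream p-prime a ⟩
  (a ^ p + 1) % p                ≡⟨ sym ([m%d+n]%d≡[m+n]%d (a ^ p) 1) ⟩
  (a ^ p % p + 1) % p            ≡⟨ cong (λ x → (x + 1) % p) (fermat's-little p-prime a) ⟩
  (a % p + 1) % p                ≡⟨ [m%d+n]%d≡[m+n]%d a 1 ⟩
  (a + 1) % p                    ≡⟨ cong (_% p) (+-comm a 1) ⟩
  suc a % p                      ∎
  where open ≡-Reasoning

x+1∣x^[1+2j]+1 : ∀ x j → x + 1 ∣ x ^ (1 + 2 * j) + 1
x+1∣x^[1+2j]+1 x zero    = subst (λ y → x + 1 ∣ y + 1) (sym (*-identityʳ x)) ∣-refl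
x+1∣x^[1+2j]+1 x (suc j) = ∣m+n∣m⇒∣n (subst (x + 1 ∣_) expand x+1∣rhs) (n∣m*n x)
  where
  y = x ^ (1 + 2 * j)
  x+1∣rhs : x + 1 ∣ x * x * (y + 1) + (x + 1)
  x+1∣rhs = ∣m∣n⇒∣m+n (∣n⇒∣m*n (x * x) (x+1∣x^[1+2j]+1 x j)) ∣-refl
  exponent : ∀ j → 1 + 2 * suc j ≡ 2 + (1 + 2 * j)
  exponent = solve-∀
  power : x ^ (1 + 2 * suc j) ≡ x * x * y
  power = trans (cong (x ^_) (exponent j))
                (trans (^-distribˡ-+-* x 2 (1 + 2 * j)) (cong (λ z → z * y) (cong (x *_) (*-identityʳ x))))
  identity : ∀ x y → x * x * (y + 1) + (x + 1) ≡ x * (x + 1) + (x * x * y + 1)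
  identity = solve-∀
  expand : x * x * (y + 1) + (x + 1) ≡ x * (x + 1) + (x ^ (1 + 2 * suc j) + 1)
  expand = trans (identity x y) (cong (λ z → x * (x + 1) + (z + 1)) (sym power))

module _ {p k} (p≡3+4k : p ≡ 3 + 4 * k) (p-prime : Prime p) where

  private instance
    p≢0 : NonZero p
    p≢0 = prime⇒nonZero p-prime

  -- If d² ≡ -1 then d^(p-1) = (d²)^(2k+1) ≡ -1, so d^p ≡ -d; with Fermat, p ∣ 2d.
  p∤d²+1 : ∀ d → ¬ p ∣ d * d + 1
  p∤d²+1 d p∣d²+1 = [ p∤2 , p∤d ]′ (euclidsLemma 2 d p-prime p∣2d)
    where
    open ≡-Reasoning
    exponent : ∀ k → 3 + 4 * k ≡ suc (2 * (1 + 2 * k))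
    exponent = solve-∀
    factor : ∀ d x → d * x + d ≡ d * (x + 1)
    factor = solve-∀
    d^p+d≡d*[[d*d]^[1+2k]+1] : d ^ p + d ≡ d * ((d * d) ^ (1 + 2 * k) + 1)
    d^p+d≡d*[[d*d]^[1+2k]+1] = begin
      d ^ p + d                               ≡⟨ cong (λ e → d ^ e + d) (trans p≡3+4k (exponent k)) ⟩
      d * d ^ (2 * (1 + 2 * k)) + d           ≡⟨ cong (λ z → d * z + d) (sym (^-*-assoc d 2 (1 + 2 * k))) ⟩
      d * (d * (d * 1)) ^ (1 + 2 * k) + d     ≡⟨ cong (λ z → d * (d * z) ^ (1 + 2 * k) + d) (*-identityʳ d) ⟩
      d * (d * d) ^ (1 + 2 * k) + d           ≡⟨ factor d ((d * d) ^ (1 + 2 * k)) ⟩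
      d * ((d * d) ^ (1 + 2 * k) + 1)         ∎
    p∣d^p+d : p ∣ d ^ p + d
    p∣d^p+d = subst (p ∣_) (sym d^p+d≡d*[[d*d]^[1+2k]+1])
      (∣n⇒∣m*n d (∣-trans p∣d²+1 (x+1∣x^[1+2j]+1 (d * d) k)))
    p∣2d : p ∣ 2 * d
    p∣2d = m%n≡0⇒n∣m (2 * d) p (begin
      (d + (d + 0)) % p     ≡⟨ cong (λ z → (d + z) % p) (+-identityʳ d) ⟩
      (d + d) % p           ≡⟨ sym ([m%d+n]%d≡[m+n]%d d d) ⟩
      (d % p + d) % p       ≡⟨ cong (λ z → (z + d) % p) (sym (fermat's-little p-prime d)) ⟩
      (d ^ p % p + d) % p   ≡⟨ [m%d+n]%d≡[m+n]%d (d ^ p) d ⟩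
      (d ^ p + d) % p       ≡⟨ n∣m⇒m%n≡0 _ p p∣d^p+d ⟩
      0                     ∎)
    p∤2 : ¬ p ∣ 2
    p∤2 p∣2 = <⇒≱ (subst (2 <_) (sym p≡3+4k) (s≤s (s≤s (s≤s z≤n)))) (∣⇒≤ p∣2)
    p∤d : ¬ p ∣ d
    p∤d p∣d = ¬prime[1] (subst Prime (∣1⇒≡1 (∣m+n∣m⇒∣n p∣d²+1 (∣m⇒∣m*n d p∣d))) p-prime)

  [d²+1]%p≡d²%p+1 : ∀ d → (d * d + 1) % p ≡ (d * d) % p + 1
  [d²+1]%p≡d²%p+1 d = begin
    (d * d + 1) % p      ≡⟨ cong (_% p) (+-comm (d * d) 1) ⟩
    suc (d * d) % p      ≡⟨ [1+m]%d≡1+m%d (d * d) (subst (λ z → ¬ p ∣ z) (+-comm (d * d) 1) (p∤d²+1 d)) ⟩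
    suc ((d * d) % p)    ≡⟨ +-comm 1 _ ⟩
    (d * d) % p + 1      ∎
    where open ≡-Reasoning

-- The identities for p = 4n − 1

3+4k∤1+16j : ∀ {k j} → 3 ≤ k → 0 < j → j < 5 → ¬ 3 + 4 * k ∣ 1 + 16 * j
3+4k∤1+16j {k} {j} 3≤k 0<j j<5 with k <? 16
... | yes k<16 = checked k<16 j<5 3≤k 0<j
  where
  checked : ∀ {k} → k < 16 → ∀ {j} → j < 5 → 3 ≤ k → 0 < j → ¬ 3 + 4 * k ∣ 1 + 16 * j
  checked = from-yes (allUpTo? (λ k → allUpTo? (λ j →
              (3 ≤? k) →-dec ((0 <? j) →-dec ¬? (3 + 4 * k ∣? 1 + 16 * j))) 5) 16)
... | no k≮16 = λ 3+4k∣1+16j → <⇒≱ 1+16j<3+4k (∣⇒≤ 3+4k∣1+16j)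
  where
  open ≤-Reasoning
  1+16j<3+4k : 1 + 16 * j < 3 + 4 * k
  1+16j<3+4k = begin-strict
    1 + 16 * j     ≤⟨ +-monoʳ-≤ 1 (*-monoʳ-≤ 16 (≤-pred j<5)) ⟩
    65             <⟨ m<m+n 65 (s≤s z≤n) ⟩
    3 + 4 * 16     ≤⟨ +-monoʳ-≤ 3 (*-monoʳ-≤ 4 (≮⇒≥ k≮16)) ⟩
    3 + 4 * k      ∎

-- n is taken of the form 2 + n₂ so that p = 4 * n ∸ 1 computes to a successor;
-- then r p, _% p and fl _ p compute, and the parts below match the theorem definitionally.
module Setting (n₂ : ℕ) (2≤n₂ : 2 ≤ n₂) (p-prime : Prime (4 * suc (suc n₂) ∸ 1)) where

  n₁ n p : ℕ
  n₁ = suc n₂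
  n = suc n₁
  p = 4 * n ∸ 1

  3≤n₁ : 3 ≤ n₁
  3≤n₁ = s≤s 2≤n₂

  p≡3+4n₁ : p ≡ 3 + 4 * n₁
  p≡3+4n₁ = cong (_∸ 1) (*-suc 4 n₁)

  g f : ℕ → ℕ
  g k = (k * k) % p
  f k = r p (ℤ.+ (k * k) ℤ.- ℤ.+ k ℤ.+ ℤ.+ 2 ℤ.- ℤ.+ (3 * n))

  N P : ℤ
  N = ℤ.+ n
  P = ℤ.+ p

  4n≡1+p : 4 * n ≡ suc p
  4n≡1+p = trans (lemma n₁) (cong suc (sym p≡3+4n₁))
    where
    lemma : ∀ m → 4 * suc m ≡ suc (3 + 4 * m)
    lemma = solve-∀

  P≡4N-1 : P ≡ ℤ.+ 4 ℤ.* N ℤ.- ℤ.+ 1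
  P≡4N-1 = trans (cong ℤ.+_ p≡3+4n₁) (trans (pos-+-* 3 4 n₁) (lemma (ℤ.+ n₁)))
    where
    lemma : ∀ x → ℤ.+ 3 ℤ.+ ℤ.+ 4 ℤ.* x ≡ ℤ.+ 4 ℤ.* (ℤ.+ 1 ℤ.+ x) ℤ.- ℤ.+ 1
    lemma = ℤ-Solver.solve-∀

  2n+2<p : 2 + 2 * n < p
  2n+2<p = begin-strict
    2 + 2 * n                 ≡⟨ lhs n₁ ⟩
    2 + (2 + 2 * n₁)          <⟨ +-monoʳ-< 2 (+-monoˡ-< (2 * n₁) (*-monoʳ-< 2 (≤-trans (s≤s (s≤s z≤n)) 3≤n₁))) ⟩
    2 + (2 * n₁ + 2 * n₁)     ≤⟨ n≤1+n _ ⟩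
    3 + (2 * n₁ + 2 * n₁)     ≡⟨ trans (rhs n₁) (sym p≡3+4n₁) ⟩
    p                         ∎
    where
    open ≤-Reasoning
    lhs : ∀ m → 2 + 2 * suc m ≡ 2 + (2 + 2 * m)
    lhs = solve-∀
    rhs : ∀ m → 3 + (2 * m + 2 * m) ≡ 3 + 4 * m
    rhs = solve-∀

  n<p : n < p
  n<p = ≤-<-trans (≤-trans (m≤n*m n 2) (m≤n+m (2 * n) 2)) 2n+2<p

  g<p : ∀ k → g k < p
  g<p k = m%n<n (k * k) p

  [d²+1]%p≡g[d]+1 : ∀ d → (d * d + 1) % p ≡ g d + 1
  [d²+1]%p≡g[d]+1 = [d²+1]%p≡d²%p+1 {k = n₁} p≡3+4n₁ p-prime

  f≡g+1 : ∀ k D → ℤ.+ D ℤ.* ℤ.+ D ≡ (ℤ.+ k ℤ.- ℤ.+ (2 * n)) ℤ.* (ℤ.+ k ℤ.- ℤ.+ (2 * n)) →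
          f k ≡ g D + 1
  f≡g+1 k D D²≡[k-2n]² = trans (x+cd≡m⇒r[x]≡m%d x (N ℤ.+ ℤ.+ 1 ℤ.- K) shift) ([d²+1]%p≡g[d]+1 D)
    where
    open ≡-Reasoning
    K = ℤ.+ k
    x = ℤ.+ (k * k) ℤ.- K ℤ.+ ℤ.+ 2 ℤ.- ℤ.+ (3 * n)
    complete-square : ∀ K N →
      K ℤ.* K ℤ.- K ℤ.+ ℤ.+ 2 ℤ.- ℤ.+ 3 ℤ.* N ℤ.+ (N ℤ.+ ℤ.+ 1 ℤ.- K) ℤ.* (ℤ.+ 4 ℤ.* N ℤ.- ℤ.+ 1)
        ≡ (K ℤ.- ℤ.+ 2 ℤ.* N) ℤ.* (K ℤ.- ℤ.+ 2 ℤ.* N) ℤ.+ ℤ.+ 1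
    complete-square = ℤ-Solver.solve-∀
    shift : x ℤ.+ (N ℤ.+ ℤ.+ 1 ℤ.- K) ℤ.* P ≡ ℤ.+ (D * D + 1)
    shift = begin
      x ℤ.+ (N ℤ.+ ℤ.+ 1 ℤ.- K) ℤ.* P
        ≡⟨ cong₂ (λ a b → a ℤ.- K ℤ.+ ℤ.+ 2 ℤ.- b ℤ.+ (N ℤ.+ ℤ.+ 1 ℤ.- K) ℤ.* P)
                 (ℤ.pos-* k k) (ℤ.pos-* 3 n) ⟩
      K ℤ.* K ℤ.- K ℤ.+ ℤ.+ 2 ℤ.- ℤ.+ 3 ℤ.* N ℤ.+ (N ℤ.+ ℤ.+ 1 ℤ.- K) ℤ.* P
        ≡⟨ cong (λ c → K ℤ.* K ℤ.- K ℤ.+ ℤ.+ 2 ℤ.- ℤ.+ 3 ℤ.* N ℤ.+ (N ℤ.+ ℤ.+ 1 ℤ.- K) ℤ.* c) P≡4N-1 ⟩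
      K ℤ.* K ℤ.- K ℤ.+ ℤ.+ 2 ℤ.- ℤ.+ 3 ℤ.* N ℤ.+ (N ℤ.+ ℤ.+ 1 ℤ.- K) ℤ.* (ℤ.+ 4 ℤ.* N ℤ.- ℤ.+ 1)
        ≡⟨ complete-square K N ⟩
      (K ℤ.- ℤ.+ 2 ℤ.* N) ℤ.* (K ℤ.- ℤ.+ 2 ℤ.* N) ℤ.+ ℤ.+ 1
        ≡⟨ cong (λ y → (K ℤ.- y) ℤ.* (K ℤ.- y) ℤ.+ ℤ.+ 1) (sym (ℤ.pos-* 2 n)) ⟩
      (K ℤ.- ℤ.+ (2 * n)) ℤ.* (K ℤ.- ℤ.+ (2 * n)) ℤ.+ ℤ.+ 1
        ≡⟨ cong (ℤ._+ ℤ.+ 1) (sym D²≡[k-2n]²) ⟩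
      ℤ.+ D ℤ.* ℤ.+ D ℤ.+ ℤ.+ 1
        ≡⟨ cong (ℤ._+ ℤ.+ 1) (sym (ℤ.pos-* D D)) ⟩
      ℤ.+ (D * D + 1)
        ∎

  f≡g[2n∸k]+1 : ∀ {k} → k ≤ 2 * n → f k ≡ g (2 * n ∸ k) + 1
  f≡g[2n∸k]+1 {k} k≤2n = f≡g+1 k (2 * n ∸ k) (begin
    ℤ.+ (2 * n ∸ k) ℤ.* ℤ.+ (2 * n ∸ k)             ≡⟨ cong (λ y → y ℤ.* y) +[2n∸k]≡2n-k ⟩
    (ℤ.+ (2 * n) ℤ.- ℤ.+ k) ℤ.* (ℤ.+ (2 * n) ℤ.- ℤ.+ k)
                                                    ≡⟨ square-neg (ℤ.+ (2 * n)) (ℤ.+ k) ⟩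
    (ℤ.+ k ℤ.- ℤ.+ (2 * n)) ℤ.* (ℤ.+ k ℤ.- ℤ.+ (2 * n)) ∎)
    where
    open ≡-Reasoning
    +[2n∸k]≡2n-k : ℤ.+ (2 * n ∸ k) ≡ ℤ.+ (2 * n) ℤ.- ℤ.+ k
    +[2n∸k]≡2n-k = sym (trans (ℤ.m-n≡m⊖n (2 * n) k) (ℤ.⊖-≥ k≤2n))
    square-neg : ∀ a b → (a ℤ.- b) ℤ.* (a ℤ.- b) ≡ (b ℤ.- a) ℤ.* (b ℤ.- a)
    square-neg = ℤ-Solver.solve-∀

  f[2n+j]≡g[j]+1 : ∀ j → f (2 * n + j) ≡ g j + 1
  f[2n+j]≡g[j]+1 j = f≡g+1 (2 * n + j) j (cong (λ y → y ℤ.* y) (begin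
    ℤ.+ j                                     ≡⟨ cancel (ℤ.+ (2 * n)) (ℤ.+ j) ⟩
    ℤ.+ (2 * n) ℤ.+ ℤ.+ j ℤ.- ℤ.+ (2 * n)     ≡⟨ cong (ℤ._- ℤ.+ (2 * n)) (sym (ℤ.pos-+ (2 * n) j)) ⟩
    ℤ.+ (2 * n + j) ℤ.- ℤ.+ (2 * n)           ∎))
    where
    open ≡-Reasoning
    cancel : ∀ a b → b ≡ a ℤ.+ b ℤ.- a
    cancel = ℤ-Solver.solve-∀

  g-sym : ∀ {a b} → a + b ≡ p → g a ≡ g b
  g-sym {a} {b} a+b≡p = begin
    (a * a) % p                    ≡⟨ sym ([m+kn]%n≡m%n (a * a) b p) ⟩
    (a * a + b * p) % p            ≡⟨ cong (λ z → (a * a + b * z) % p) (sym a+b≡p) ⟩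
    (a * a + b * (a + b)) % p      ≡⟨ cong (_% p) (swap a b) ⟩
    (b * b + a * (a + b)) % p      ≡⟨ cong (λ z → (b * b + a * z) % p) a+b≡p ⟩
    (b * b + a * p) % p            ≡⟨ [m+kn]%n≡m%n (b * b) a p ⟩
    (b * b) % p                    ∎
    where
    open ≡-Reasoning
    swap : ∀ a b → a * a + b * (a + b) ≡ b * b + a * (a + b)
    swap = solve-∀

  g[2n]≡n : g (2 * n) ≡ n
  g[2n]≡n = begin
    (2 * n * (2 * n)) % p     ≡⟨ cong (_% p) (trans (square n) (cong (n *_) 4n≡1+p)) ⟩
    (n * suc p) % p           ≡⟨ cong (_% p) (*-suc n p) ⟩
    (n + n * p) % p           ≡⟨ r+kd%d≡r n n<p ⟩
    n                         ∎
    where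
    open ≡-Reasoning
    square : ∀ n → 2 * n * (2 * n) ≡ n * (4 * n)
    square = solve-∀

  L : ℕ
  L = suc (2 * n₁)

  2n≡1+L : 2 * n ≡ suc L
  2n≡1+L = lemma n₁
    where
    lemma : ∀ m → 2 * suc m ≡ suc (suc (2 * m))
    lemma = solve-∀

  p∸1≡L+L : p ∸ 1 ≡ L + L
  p∸1≡L+L = trans (cong (_∸ 1) p≡3+4n₁) (lemma n₁)
    where
    lemma : ∀ m → 2 + 4 * m ≡ suc (2 * m) + suc (2 * m)
    lemma = solve-∀

  g[L]≡n : g L ≡ n
  g[L]≡n = trans (cong (_% p) (trans (square n₁) (cong (λ q → n + n₁ * q) (sym p≡3+4n₁)))) (r+kd%d≡r n₁ n<p)
    where
    square : ∀ m → suc (2 * m) * suc (2 * m) ≡ suc m + m * (3 + 4 * m)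
    square = solve-∀

  ∑g : ℕ → ℕ
  ∑g N = ∑< N (λ i → g (suc i))

  ∑f<2n : ∑< (2 * n) (λ i → f (suc i)) ≡ ∑g L + 2 * n * 1
  ∑f<2n = begin
    ∑< (2 * n) (λ i → f (suc i))                            ≡⟨ ∑<-cong (2 * n) (λ i i<2n → f≡g[2n∸k]+1 i<2n) ⟩
    ∑< (2 * n) (λ i → g (2 * n ∸ suc i) + 1)                ≡⟨ ∑<-distrib-+ (2 * n) (λ i → g (2 * n ∸ suc i)) (λ _ → 1) ⟩
    ∑< (2 * n) (λ i → g (2 * n ∸ suc i)) + ∑< (2 * n) (λ _ → 1)
                                                            ≡⟨ cong₂ _+_ (∑<-reverse (2 * n) g) (∑<-const (2 * n) 1) ⟩
    ∑< (2 * n) g + 2 * n * 1                                ≡⟨ cong (λ N → ∑< N g + 2 * n * 1) 2n≡1+L ⟩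
    ∑< (suc L) g + 2 * n * 1                                ≡⟨ cong (_+ 2 * n * 1) (∑<-suc L g) ⟩
    ∑g L + 2 * n * 1                                        ∎
    where open ≡-Reasoning

  ∑g[L]≡n+∑g[2n₁] : ∑g L ≡ n + ∑g (2 * n₁)
  ∑g[L]≡n+∑g[2n₁] = cong (_+ ∑g (2 * n₁)) g[L]≡n

  ∑g[2n]≡n+∑g[L] : ∑g (2 * n) ≡ n + ∑g L
  ∑g[2n]≡n+∑g[L] = trans (cong ∑g 2n≡1+L) (cong (_+ ∑g L) (trans (cong g (sym 2n≡1+L)) g[2n]≡n))

  ∑g[L+L]≡∑g[L]+∑g[L] : ∑g (L + L) ≡ ∑g L + ∑g L
  ∑g[L+L]≡∑g[L]+∑g[L] = begin
    ∑g (L + L)                                  ≡⟨ ∑<-+ L L (λ i → g (suc i)) ⟩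
    ∑g L + ∑< L (λ i → g (suc (L + i)))         ≡⟨ cong (∑g L +_) (∑<-cong L (λ i i<L → g-sym {suc (L + i)} (mirror i<L))) ⟩
    ∑g L + ∑< L (λ i → g (suc (L ∸ suc i)))     ≡⟨ cong (∑g L +_) (∑<-reverse L (λ i → g (suc i))) ⟩
    ∑g L + ∑g L                                 ∎
    where
    open ≡-Reasoning
    shuffle : ∀ L i v → suc (L + i) + suc v ≡ suc (L + (v + suc i))
    shuffle = solve-∀
    mirror : ∀ {i} → i < L → suc (L + i) + suc (L ∸ suc i) ≡ p
    mirror {i} i<L = begin
      suc (L + i) + suc (L ∸ suc i)     ≡⟨ shuffle L i (L ∸ suc i) ⟩
      suc (L + (L ∸ suc i + suc i))     ≡⟨ cong (λ z → suc (L + z)) (m∸n+n≡m i<L) ⟩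
      suc (L + L)                       ≡⟨ cong suc (sym p∸1≡L+L) ⟩
      p                                 ∎

  part₂ : sumFromTo 1 (2 * n) f ≡ sumFromTo 1 (2 * n) g + n
  part₂ = begin
    sumFromTo 1 (2 * n) f         ≡⟨ sumFromTo1≡∑< (2 * n) f ⟩
    ∑< (2 * n) (λ i → f (suc i))  ≡⟨ ∑f<2n ⟩
    ∑g L + 2 * n * 1              ≡⟨ rearrange (∑g L) n₁ ⟩
    n + ∑g L + n                  ≡⟨ cong (_+ n) (sym ∑g[2n]≡n+∑g[L]) ⟩
    ∑g (2 * n) + n                ≡⟨ cong (_+ n) (sym (sumFromTo1≡∑< (2 * n) g)) ⟩
    sumFromTo 1 (2 * n) g + n     ∎
    where
    open ≡-Reasoning
    rearrange : ∀ S m → S + 2 * suc m * 1 ≡ suc m + S + suc m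
    rearrange = solve-∀

  part₁ : sumFromTo 1 (p ∸ 1) f ≡ sumFromTo 1 (p ∸ 1) g + (3 * n ∸ 2)
  part₁ = begin
    sumFromTo 1 (p ∸ 1) f
      ≡⟨ sumFromTo1≡∑< (p ∸ 1) f ⟩
    ∑< (p ∸ 1) (λ i → f (suc i))
      ≡⟨ cong (λ N → ∑< N (λ i → f (suc i))) (trans p∸1≡L+L (L+L≡2n+2n₁ n₁)) ⟩
    ∑< (2 * n + 2 * n₁) (λ i → f (suc i))
      ≡⟨ ∑<-+ (2 * n) (2 * n₁) (λ i → f (suc i)) ⟩
    ∑< (2 * n) (λ i → f (suc i)) + ∑< (2 * n₁) (λ i → f (suc (2 * n + i)))
      ≡⟨ cong₂ _+_ ∑f<2n ∑f-tail ⟩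
    ∑g L + 2 * n * 1 + (S + 2 * n₁ * 1)
      ≡⟨ cong (λ z → z + 2 * n * 1 + (S + 2 * n₁ * 1)) ∑g[L]≡n+∑g[2n₁] ⟩
    n + S + 2 * n * 1 + (S + 2 * n₁ * 1)
      ≡⟨ rearrange S n₁ ⟩
    (n + S) + (n + S) + suc (3 * n₁)
      ≡⟨ cong (λ z → z + z + suc (3 * n₁)) (sym ∑g[L]≡n+∑g[2n₁]) ⟩
    ∑g L + ∑g L + suc (3 * n₁)
      ≡⟨ cong₂ _+_ (sym ∑g[L+L]≡∑g[L]+∑g[L]) (sym 3n∸2≡1+3n₁) ⟩
    ∑g (L + L) + (3 * n ∸ 2)
      ≡⟨ cong (λ N → ∑g N + (3 * n ∸ 2)) (sym p∸1≡L+L) ⟩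
    ∑g (p ∸ 1) + (3 * n ∸ 2)
      ≡⟨ cong (_+ (3 * n ∸ 2)) (sym (sumFromTo1≡∑< (p ∸ 1) g)) ⟩
    sumFromTo 1 (p ∸ 1) g + (3 * n ∸ 2)
      ∎
    where
    open ≡-Reasoning
    L+L≡2n+2n₁ : ∀ m → suc (2 * m) + suc (2 * m) ≡ 2 * suc m + 2 * m
    L+L≡2n+2n₁ = solve-∀
    S : ℕ
    S = ∑g (2 * n₁)
    ∑f-tail : ∑< (2 * n₁) (λ i → f (suc (2 * n + i))) ≡ S + 2 * n₁ * 1
    ∑f-tail = begin
      ∑< (2 * n₁) (λ i → f (suc (2 * n + i)))
        ≡⟨ ∑<-cong (2 * n₁) (λ i _ → trans (cong f (sym (+-suc (2 * n) i))) (f[2n+j]≡g[j]+1 (suc i))) ⟩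
      ∑< (2 * n₁) (λ i → g (suc i) + 1)
        ≡⟨ ∑<-distrib-+ (2 * n₁) (λ i → g (suc i)) (λ _ → 1) ⟩
      S + ∑< (2 * n₁) (λ _ → 1)
        ≡⟨ cong (S +_) (∑<-const (2 * n₁) 1) ⟩
      S + 2 * n₁ * 1
        ∎
    3n∸2≡1+3n₁ : 3 * n ∸ 2 ≡ suc (3 * n₁)
    3n∸2≡1+3n₁ = cong (_∸ 2) (lemma n₁)
      where
      lemma : ∀ m → 3 * suc m ≡ 2 + suc (3 * m)
      lemma = solve-∀
    rearrange : ∀ S m → suc m + S + 2 * suc m * 1 + (S + 2 * m * 1)
                        ≡ (suc m + S) + (suc m + S) + suc (3 * m)
    rearrange = solve-∀

  c : ℕ → ℕ
  c k = (g k + (n ∸ k)) / p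

  C : ℕ
  C = ∑< n (λ i → c (suc i))

  g[2n∸k]≡[g[k]+n∸k]%p : ∀ {k} → k ≤ n → g (2 * n ∸ k) ≡ (g k + (n ∸ k)) % p
  g[2n∸k]≡[g[k]+n∸k]%p {k} k≤n = begin
    g (2 * n ∸ k)                             ≡⟨ cong g 2n∸k≡k+2u ⟩
    ((k + (u + u)) * (k + (u + u))) % p       ≡⟨ cong (_% p) (square k u) ⟩
    (k * k + u * (4 * (k + u))) % p           ≡⟨ cong (λ z → (k * k + u * (4 * z)) % p) k+u≡n ⟩
    (k * k + u * (4 * n)) % p                 ≡⟨ cong (λ z → (k * k + u * z) % p) 4n≡1+p ⟩
    (k * k + u * suc p) % p                   ≡⟨ cong (_% p) (regroup (k * k) u p) ⟩
    (k * k + u + u * p) % p                   ≡⟨ [m+kn]%n≡m%n (k * k + u) u p ⟩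
    (k * k + u) % p                           ≡⟨ sym ([m%d+n]%d≡[m+n]%d (k * k) u) ⟩
    (g k + u) % p                             ∎
    where
    open ≡-Reasoning
    u = n ∸ k
    k+u≡n : k + u ≡ n
    k+u≡n = m+[n∸m]≡n k≤n
    double : ∀ k u → 2 * (k + u) ∸ k ≡ k + (u + u)
    double k u = trans (cong (_∸ k) (lemma k u)) (m+n∸m≡n k (k + (u + u)))
      where
      lemma : ∀ k u → 2 * (k + u) ≡ k + (k + (u + u))
      lemma = solve-∀
    2n∸k≡k+2u : 2 * n ∸ k ≡ k + (u + u)
    2n∸k≡k+2u = trans (cong (λ z → 2 * z ∸ k) (sym k+u≡n)) (double k u)
    square : ∀ k u → (k + (u + u)) * (k + (u + u)) ≡ k * k + u * (4 * (k + u))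
    square = solve-∀
    regroup : ∀ a u p → a + u * suc p ≡ a + u + u * p
    regroup = solve-∀

  g[2n∸k]+pc[k]≡g[k]+n∸k : ∀ {k} → k ≤ n → g (2 * n ∸ k) + p * c k ≡ g k + (n ∸ k)
  g[2n∸k]+pc[k]≡g[k]+n∸k {k} k≤n = begin
    g (2 * n ∸ k) + p * c k       ≡⟨ cong₂ _+_ (g[2n∸k]≡[g[k]+n∸k]%p k≤n) (*-comm p (c k)) ⟩
    x % p + x / p * p             ≡⟨ sym (m≡m%n+[m/n]*n x p) ⟩
    x                             ∎
    where
    open ≡-Reasoning
    x = g k + (n ∸ k)

  ∑f≤n+pC≡∑g≤n+n[n+1]/2 : sumFromTo 1 n f + p * C ≡ sumFromTo 1 n g + (n * (n + 1)) / 2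
  ∑f≤n+pC≡∑g≤n+n[n+1]/2 = begin
    sumFromTo 1 n f + p * C
      ≡⟨ cong₂ _+_ (sumFromTo1≡∑< n f) (sym (∑<-distribˡ-* n p (λ i → c (suc i)))) ⟩
    ∑< n (λ i → f (suc i)) + ∑< n (λ i → p * c (suc i))
      ≡⟨ sym (∑<-distrib-+ n (λ i → f (suc i)) (λ i → p * c (suc i))) ⟩
    ∑< n (λ i → f (suc i) + p * c (suc i))
      ≡⟨ ∑<-cong n (λ i i<n → termwise i<n) ⟩
    ∑< n (λ i → g (suc i) + suc (n ∸ suc i))
      ≡⟨ ∑<-distrib-+ n (λ i → g (suc i)) (λ i → suc (n ∸ suc i)) ⟩
    ∑g n + ∑< n (λ i → suc (n ∸ suc i))
      ≡⟨ cong (∑g n +_) (trans (∑<-reverse n suc) (∑<-suc≡triangle n)) ⟩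
    ∑g n + (n * (n + 1)) / 2
      ≡⟨ cong (_+ (n * (n + 1)) / 2) (sym (sumFromTo1≡∑< n g)) ⟩
    sumFromTo 1 n g + (n * (n + 1)) / 2
      ∎
    where
    open ≡-Reasoning
    termwise : ∀ {i} → i < n → f (suc i) + p * c (suc i) ≡ g (suc i) + suc (n ∸ suc i)
    termwise {i} i<n = begin
      f (suc i) + p * c (suc i)                       ≡⟨ cong (_+ p * c (suc i)) (f≡g[2n∸k]+1 (≤-trans i<n (m≤n*m n 2))) ⟩
      g (2 * n ∸ suc i) + 1 + p * c (suc i)           ≡⟨ xy∙z≈xz∙y (g (2 * n ∸ suc i)) 1 (p * c (suc i)) ⟩
      g (2 * n ∸ suc i) + p * c (suc i) + 1           ≡⟨ cong (_+ 1) (g[2n∸k]+pc[k]≡g[k]+n∸k i<n) ⟩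
      g (suc i) + (n ∸ suc i) + 1                     ≡⟨ +-assoc (g (suc i)) (n ∸ suc i) 1 ⟩
      g (suc i) + (n ∸ suc i + 1)                     ≡⟨ cong (g (suc i) +_) (+-comm (n ∸ suc i) 1) ⟩
      g (suc i) + suc (n ∸ suc i)                     ∎

  F b : ℕ → ℕ
  F m = (m * m) / p
  b m = (g m + (m + suc n)) / p

  i+n+2<p : ∀ {i} → i ≤ n → suc i + suc n < p
  i+n+2<p {i} i≤n = ≤-<-trans (+-monoˡ-≤ (suc n) (s≤s i≤n)) (subst (_< p) (two n) 2n+2<p)
    where
    two : ∀ n → 2 + 2 * n ≡ suc n + suc n
    two = solve-∀

  r[k+1-3n]≡k+n : ∀ {i} → i ≤ n → r p (ℤ.+ (2 + i) ℤ.+ ℤ.+ 1 ℤ.- ℤ.+ (3 * n)) ≡ suc i + suc n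
  r[k+1-3n]≡k+n {i} i≤n = trans (x+cd≡m⇒r[x]≡m%d x (ℤ.+ 1) shift) (m<n⇒m%n≡m (i+n+2<p i≤n))
    where
    open ≡-Reasoning
    I = ℤ.+ i
    x = ℤ.+ (2 + i) ℤ.+ ℤ.+ 1 ℤ.- ℤ.+ (3 * n)
    collect : ∀ I N → ℤ.+ 2 ℤ.+ I ℤ.+ ℤ.+ 1 ℤ.- ℤ.+ 3 ℤ.* N ℤ.+ ℤ.+ 1 ℤ.* (ℤ.+ 4 ℤ.* N ℤ.- ℤ.+ 1)
                      ≡ (ℤ.+ 1 ℤ.+ I) ℤ.+ (ℤ.+ 1 ℤ.+ N)
    collect = ℤ-Solver.solve-∀
    shift : x ℤ.+ ℤ.+ 1 ℤ.* P ≡ ℤ.+ (suc i + suc n)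
    shift = begin
      x ℤ.+ ℤ.+ 1 ℤ.* P
        ≡⟨ cong₂ (λ a z → a ℤ.+ ℤ.+ 1 ℤ.- z ℤ.+ ℤ.+ 1 ℤ.* P) (ℤ.pos-+ 2 i) (ℤ.pos-* 3 n) ⟩
      ℤ.+ 2 ℤ.+ I ℤ.+ ℤ.+ 1 ℤ.- ℤ.+ 3 ℤ.* N ℤ.+ ℤ.+ 1 ℤ.* P
        ≡⟨ cong (λ z → ℤ.+ 2 ℤ.+ I ℤ.+ ℤ.+ 1 ℤ.- ℤ.+ 3 ℤ.* N ℤ.+ ℤ.+ 1 ℤ.* z) P≡4N-1 ⟩
      ℤ.+ 2 ℤ.+ I ℤ.+ ℤ.+ 1 ℤ.- ℤ.+ 3 ℤ.* N ℤ.+ ℤ.+ 1 ℤ.* (ℤ.+ 4 ℤ.* N ℤ.- ℤ.+ 1)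
        ≡⟨ collect I N ⟩
      ℤ.+ (suc i) ℤ.+ ℤ.+ (suc n)
        ≡⟨ sym (ℤ.pos-+ (suc i) (suc n)) ⟩
      ℤ.+ (suc i + suc n)
        ∎

  J≡∑b : J n ≡ ∑< (suc n) (λ i → b (suc i))
  J≡∑b = begin
    J n                                   ≡⟨ cong (λ m → sumFromTo 2 m indicator) (+-comm n 2) ⟩
    sumFromTo 2 (suc (suc n)) indicator   ≡⟨ sumFromTo2≡∑< (suc n) indicator ⟩
    ∑< (suc n) (λ i → indicator (2 + i))  ≡⟨ ∑<-cong (suc n) (λ i i<1+n → indicator≡b (≤-pred i<1+n)) ⟩
    ∑< (suc n) (λ i → b (suc i))          ∎
    where
    open ≡-Reasoning
    wraps : ℕ → ℕ → Bool
    wraps q k = does (q ≤? (r q ((ℤ.+ k ℤ.- ℤ.+ 1) ℤ.* (ℤ.+ k ℤ.- ℤ.+ 1))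
                           + r q (ℤ.+ k ℤ.+ ℤ.+ 1 ℤ.- ℤ.+ (3 * n))))
    indicator : ℕ → ℕ
    indicator k = if wraps p k then 1 else 0
    indicator≡b : ∀ {i} → i ≤ n → indicator (2 + i) ≡ b (suc i)
    indicator≡b {i} i≤n = begin
      indicator (2 + i)
        ≡⟨ cong (λ z → if does (p ≤? (g (suc i) + z)) then 1 else 0) (r[k+1-3n]≡k+n i≤n) ⟩
      (if does (p ≤? (g (suc i) + (suc i + suc n))) then 1 else 0)
        ≡⟨ [d≤x]≡x/d (+-mono-< (g<p (suc i)) (i+n+2<p i≤n)) ⟩
      b (suc i)
        ∎

  b[m]+F[m]≡[m²+m+n+1]/p : ∀ m → b m + F m ≡ (m * m + (m + suc n)) / p
  b[m]+F[m]≡[m²+m+n+1]/p m = trans (+-comm (b m) (F m)) (sym ([m+n]/d≡m/d+[m%d+n]/d (m * m) (m + suc n)))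

  p∤1+m²+m+n : ∀ m → ¬ p ∣ suc (m * m + (m + n))
  p∤1+m²+m+n m p∣1+m²+m+n = p∤d²+1 {k = n₁} p≡3+4n₁ p-prime (m + 2 * n) (subst (p ∣_) (sym expand)
    (∣m∣n⇒∣m+n p∣1+m²+m+n (n∣m*n (m + n))))
    where
    open ≡-Reasoning
    square : ∀ m n → (m + 2 * n) * (m + 2 * n) + 1 ≡ m * m + m * (4 * n) + n * (4 * n) + 1
    square = solve-∀
    regroup : ∀ m n p → m * m + m * suc p + n * suc p + 1 ≡ suc (m * m + (m + n)) + (m + n) * p
    regroup = solve-∀
    expand : (m + 2 * n) * (m + 2 * n) + 1 ≡ suc (m * m + (m + n)) + (m + n) * p
    expand = begin
      (m + 2 * n) * (m + 2 * n) + 1              ≡⟨ square m n ⟩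
      m * m + m * (4 * n) + n * (4 * n) + 1      ≡⟨ cong (λ z → m * m + m * z + n * z + 1) 4n≡1+p ⟩
      m * m + m * suc p + n * suc p + 1          ≡⟨ regroup m n p ⟩
      suc (m * m + (m + n)) + (m + n) * p        ∎

  b[m]+F[m]≡c[m+1]+F[m+1] : ∀ {m} → m < n → b m + F m ≡ c (suc m) + F (suc m)
  b[m]+F[m]≡c[m+1]+F[m+1] {m} m<n = begin
    b m + F m                                   ≡⟨ b[m]+F[m]≡[m²+m+n+1]/p m ⟩
    (m * m + (m + suc n)) / p                   ≡⟨ cong (_/ p) (trans (cong (m * m +_) (+-suc m n)) (+-suc (m * m) (m + n))) ⟩
    suc (m * m + (m + n)) / p                   ≡⟨ [1+m]/d≡m/d (m * m + (m + n)) (p∤1+m²+m+n m) ⟩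
    (m * m + (m + n)) / p                       ≡⟨ cong (_/ p) (sym square+rest) ⟩
    (suc m * suc m + u) / p                     ≡⟨ [m+n]/d≡m/d+[m%d+n]/d {p} (suc m * suc m) u ⟩
    F (suc m) + c (suc m)                       ≡⟨ +-comm (F (suc m)) (c (suc m)) ⟩
    c (suc m) + F (suc m)                       ∎
    where
    open ≡-Reasoning
    u = n ∸ suc m
    expand : ∀ m u → suc m * suc m + u ≡ m * m + (m + (suc m + u))
    expand = solve-∀
    square+rest : suc m * suc m + u ≡ m * m + (m + n)
    square+rest = trans (expand m u) (cong (λ z → m * m + (m + z)) (m+[n∸m]≡n m<n))

  -- 16 n² ≡ 1 (mod p), so g n = p − j with 1 ≤ j ≤ 4 would give p ∣ 16 j + 1.
  g[n]+4<p : g n + 4 < p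
  g[n]+4<p with suc (g n + 4) ≤? p
  ... | yes below = below
  ... | no  g[n]+4≮p = ⊥-elim (3+4k∤1+16j 3≤n₁ 0<j j<5 (subst (_∣ 1 + 16 * j) p≡3+4n₁ p∣1+16j))
    where
    open ≡-Reasoning
    j = p ∸ g n
    g+j≡p : g n + j ≡ p
    g+j≡p = m+[n∸m]≡n (<⇒≤ (g<p n))
    0<j : 0 < j
    0<j = m<n⇒0<n∸m (g<p n)
    j<5 : j < 5
    j<5 = s≤s (≤-trans (∸-monoˡ-≤ (g n) (≤-pred (≰⇒> g[n]+4≮p))) (≤-reflexive (m+n∸m≡n (g n) 4)))
    identity : p * (16 + 16 * F n) ≡ p * (p + 2) + (1 + 16 * j)
    identity = begin
      p * (16 + 16 * F n)                     ≡⟨ distribute p (F n) ⟩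
      16 * p + 16 * (F n * p)                 ≡⟨ cong (λ z → 16 * z + 16 * (F n * p)) (sym g+j≡p) ⟩
      16 * (g n + j) + 16 * (F n * p)         ≡⟨ regroup (g n) j (F n * p) ⟩
      16 * (g n + F n * p) + 16 * j           ≡⟨ cong (λ z → 16 * z + 16 * j) (sym (m≡m%n+[m/n]*n (n * n) p)) ⟩
      16 * (n * n) + 16 * j                   ≡⟨ cong (_+ 16 * j) (square n) ⟩
      4 * n * (4 * n) + 16 * j                ≡⟨ cong (λ z → z * z + 16 * j) 4n≡1+p ⟩
      suc p * suc p + 16 * j                  ≡⟨ expand p j ⟩
      p * (p + 2) + (1 + 16 * j)              ∎
      where
      distribute : ∀ p F → p * (16 + 16 * F) ≡ 16 * p + 16 * (F * p)
      distribute = solve-∀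
      regroup : ∀ g j x → 16 * (g + j) + 16 * x ≡ 16 * (g + x) + 16 * j
      regroup = solve-∀
      square : ∀ n → 16 * (n * n) ≡ 4 * n * (4 * n)
      square = solve-∀
      expand : ∀ p j → suc p * suc p + 16 * j ≡ p * (p + 2) + (1 + 16 * j)
      expand = solve-∀
    p∣1+16j : p ∣ 1 + 16 * j
    p∣1+16j = ∣m+n∣m⇒∣n (subst (p ∣_) identity (m∣m*n (16 + 16 * F n))) (m∣m*n (p + 2))

  b[n]+F[n]≡F[n+1] : b n + F n ≡ F (suc n)
  b[n]+F[n]≡F[n+1] = trans (b[m]+F[m]≡[m²+m+n+1]/p n) (cong (_/ p) (square n))
    where
    square : ∀ n → n * n + (n + suc n) ≡ suc n * suc n
    square = solve-∀

  b[n+1]+F[n+1]≡1+F[n] : b (suc n) + F (suc n) ≡ suc (F n)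
  b[n+1]+F[n+1]≡1+F[n] = begin
    b (suc n) + F (suc n)                          ≡⟨ b[m]+F[m]≡[m²+m+n+1]/p (suc n) ⟩
    (suc n * suc n + (suc n + suc n)) / p          ≡⟨ cong (_/ p) (expand n) ⟩
    (n * n + 3 + 4 * n) / p                        ≡⟨ cong (λ z → (n * n + 3 + z) / p) 4n≡1+p ⟩
    (n * n + 3 + suc p) / p                        ≡⟨ cong (_/ p) (shift (n * n) p) ⟩
    (n * n + 4 + p) / p                            ≡⟨ +-distrib-/-∣ʳ (n * n + 4) (∣-refl {p}) ⟩
    (n * n + 4) / p + p / p                        ≡⟨ cong₂ _+_ ([m+n]/d≡m/d+[m%d+n]/d {p} (n * n) 4) (n/n≡1 p) ⟩
    F n + (g n + 4) / p + 1                        ≡⟨ cong (λ z → F n + z + 1) (m<n⇒m/n≡0 g[n]+4<p) ⟩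
    F n + 0 + 1                                    ≡⟨ cong (_+ 1) (+-identityʳ (F n)) ⟩
    F n + 1                                        ≡⟨ +-comm (F n) 1 ⟩
    suc (F n)                                      ∎
    where
    open ≡-Reasoning
    expand : ∀ n → suc n * suc n + (suc n + suc n) ≡ n * n + 3 + 4 * n
    expand = solve-∀
    shift : ∀ a p → a + 3 + suc p ≡ a + 4 + p
    shift = solve-∀

  J≡C+1+M : J n ≡ C + 1 + F n
  J≡C+1+M = +-cancelʳ-≡ (F n + F (suc n)) (J n) (C + 1 + F n) (begin
    J n + (F n + F (suc n))
      ≡⟨ cong (_+ (F n + F (suc n))) J≡∑b ⟩
    b (suc n) + (b n + B′) + (F n + F (suc n))
      ≡⟨ regroup (b (suc n)) (b n) B′ (F n) (F (suc n)) ⟩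
    (b (suc n) + F (suc n)) + (b n + F n) + B′
      ≡⟨ cong₂ (λ x y → x + y + B′) b[n+1]+F[n+1]≡1+F[n] b[n]+F[n]≡F[n+1] ⟩
    suc (F n) + F (suc n) + B′
      ≡⟨ cong (suc (F n) + F (suc n) +_) B′≡C′+F[n] ⟩
    suc (F n) + F (suc n) + (C′ + F n)
      ≡⟨ regroup′ (F n) (F (suc n)) C′ ⟩
    0 + C′ + 1 + F n + (F n + F (suc n))
      ≡⟨ cong (λ z → z + C′ + 1 + F n + (F n + F (suc n))) (sym c[1]≡0) ⟩
    c 1 + C′ + 1 + F n + (F n + F (suc n))
      ≡⟨ cong (λ z → z + 1 + F n + (F n + F (suc n))) (sym (∑<-suc n₁ (λ i → c (suc i)))) ⟩
    C + 1 + F n + (F n + F (suc n))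
      ∎)
    where
    open ≡-Reasoning
    B′ C′ : ℕ
    B′ = ∑< n₁ (λ i → b (suc i))
    C′ = ∑< n₁ (λ i → c (suc (suc i)))
    1<p : 1 < p
    1<p = ≤-<-trans (s≤s z≤n) n<p
    c[1]≡0 : c 1 ≡ 0
    c[1]≡0 = trans (cong (λ z → (z + n₁) / p) (m<n⇒m%n≡m 1<p)) (m<n⇒m/n≡0 n<p)
    F[1]≡0 : F 1 ≡ 0
    F[1]≡0 = m<n⇒m/n≡0 1<p
    B′≡C′+F[n] : B′ ≡ C′ + F n
    B′≡C′+F[n] = begin
      B′                  ≡⟨ sym (+-identityʳ B′) ⟩
      B′ + 0              ≡⟨ cong (B′ +_) (sym F[1]≡0) ⟩
      B′ + F 1            ≡⟨ ∑<-telescope n₁ {λ i → b (suc i)} {λ i → c (suc (suc i))} {λ i → F (suc i)}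
                                            (λ i i<n₁ → b[m]+F[m]≡c[m+1]+F[m+1] (s≤s i<n₁)) ⟩
      C′ + F n            ∎
    regroup : ∀ a b B x y → a + (b + B) + (x + y) ≡ (a + y) + (b + x) + B
    regroup = solve-∀
    regroup′ : ∀ x y C → suc x + y + (C + x) ≡ 0 + C + 1 + x + (x + y)
    regroup′ = solve-∀

  part₃ : ℤ.+ sumFromTo 1 n f
          ≡ ℤ.+ sumFromTo 1 n g ℤ.+ ℤ.+ ((n * (n + 1)) / 2) ℤ.- ℤ.+ p ℤ.* (ℤ.+ J n ℤ.- ℤ.+ 1 ℤ.- ℤ.+ F n)
  part₃ = isolate {sumFromTo 1 n f} {sumFromTo 1 n g} {(n * (n + 1)) / 2} {p} {C} {J n} {F n}
            ∑f≤n+pC≡∑g≤n+n[n+1]/2 J≡C+1+M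
    where
    isolate : ∀ {a b t q c j m} → a + q * c ≡ b + t → j ≡ c + 1 + m →
              ℤ.+ a ≡ ℤ.+ b ℤ.+ ℤ.+ t ℤ.- ℤ.+ q ℤ.* (ℤ.+ j ℤ.- ℤ.+ 1 ℤ.- ℤ.+ m)
    isolate {a} {b} {t} {q} {c} {j} {m} a+qc≡b+t refl = begin
      ℤ.+ a
        ≡⟨ add-sub (ℤ.+ a) (Q ℤ.* ℤ.+ c) ⟩
      ℤ.+ a ℤ.+ Q ℤ.* ℤ.+ c ℤ.- Q ℤ.* ℤ.+ c
        ≡⟨ cong (ℤ._- Q ℤ.* ℤ.+ c) (sym (pos-+-* a q c)) ⟩
      ℤ.+ (a + q * c) ℤ.- Q ℤ.* ℤ.+ c
        ≡⟨ cong (λ z → ℤ.+ z ℤ.- Q ℤ.* ℤ.+ c) a+qc≡b+t ⟩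
      ℤ.+ (b + t) ℤ.- Q ℤ.* ℤ.+ c
        ≡⟨ cong (ℤ._- Q ℤ.* ℤ.+ c) (ℤ.pos-+ b t) ⟩
      ℤ.+ b ℤ.+ ℤ.+ t ℤ.- Q ℤ.* ℤ.+ c
        ≡⟨ cancel (ℤ.+ b ℤ.+ ℤ.+ t) Q (ℤ.+ c) (ℤ.+ m) ⟩
      ℤ.+ b ℤ.+ ℤ.+ t ℤ.- Q ℤ.* (ℤ.+ c ℤ.+ ℤ.+ 1 ℤ.+ ℤ.+ m ℤ.- ℤ.+ 1 ℤ.- ℤ.+ m)
        ≡⟨ cong (λ z → ℤ.+ b ℤ.+ ℤ.+ t ℤ.- Q ℤ.* (z ℤ.- ℤ.+ 1 ℤ.- ℤ.+ m)) (sym (pos-+-+ c 1 m)) ⟩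
      ℤ.+ b ℤ.+ ℤ.+ t ℤ.- Q ℤ.* (ℤ.+ (c + 1 + m) ℤ.- ℤ.+ 1 ℤ.- ℤ.+ m)
        ∎
      where
      open ≡-Reasoning
      Q = ℤ.+ q
      add-sub : ∀ x y → x ≡ x ℤ.+ y ℤ.- y
      add-sub = ℤ-Solver.solve-∀
      cancel : ∀ x Q c m → x ℤ.- Q ℤ.* c ≡ x ℤ.- Q ℤ.* (c ℤ.+ ℤ.+ 1 ℤ.+ m ℤ.- ℤ.+ 1 ℤ.- m)
      cancel = ℤ-Solver.solve-∀
      pos-+-+ : ∀ a b c → ℤ.+ (a + b + c) ≡ ℤ.+ a ℤ.+ ℤ.+ b ℤ.+ ℤ.+ c
      pos-+-+ a b c = trans (ℤ.pos-+ (a + b) c) (cong (ℤ._+ ℤ.+ c) (ℤ.pos-+ a b))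

theorem5p1 : (n : ℕ) → 3 < n → Prime (4 ℕ.* n ∸ 1) →
    let p = 4 ℕ.* n ∸ 1
        M = fl (n ℕ.* n) (4 ℕ.* n ∸ 1)
        f = λ (k : ℕ) → r p (ℤ.+ (k ℕ.* k) ℤ.- ℤ.+ k ℤ.+ ℤ.+ 2 ℤ.- ℤ.+ (3 ℕ.* n))
        g = λ (k : ℕ) → r p (ℤ.+ (k ℕ.* k))
    in (sumFromTo 1 (p ∸ 1) f ≡ sumFromTo 1 (p ∸ 1) g ℕ.+ (3 ℕ.* n ∸ 2))
       × (sumFromTo 1 (2 ℕ.* n) f ≡ sumFromTo 1 (2 ℕ.* n) g ℕ.+ n)
       × (ℤ.+ sumFromTo 1 n f
           ≡ ℤ.+ sumFromTo 1 n g ℤ.+ ℤ.+ ((n ℕ.* (n ℕ.+ 1)) / 2)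
             ℤ.- ℤ.+ p ℤ.* (ℤ.+ J n ℤ.- ℤ.+ 1 ℤ.- ℤ.+ M))
theorem5p1 (suc (suc n₂)) (s≤s (s≤s 2≤n₂)) p-prime = part₁ , part₂ , part₃
  where open Setting n₂ 2≤n₂ p-prime
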